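{- Let $G=(V,E)$ be a $2$-edge-strongly biconnected directed graph and let $U\subseteq E$ be an optimal solution of the minimum $2$-edge strongly biconnected spanning subgraph problem for $G$ (i.e. a minimum-size subset $U\subseteq E$ such that $(V,U)$ is $2$-edge-strongly biconnected). Then the subgraph $(V,U)$ has at least $2n$ edges, where $n=|V|$.
   Context: A directed graph is strongly biconnected if it is strongly connected and its underlying undirected graph is biconnected. An edge $e$ of a strongly biconnected directed graph $(V,E)$ is a b-bridge if $(V,E\setminus\{e\})$ is not strongly biconnected. A strongly biconnected directed graph $(V,E)$ is $2$-edge-strongly biconnected if it has at least three vertices and $(V,E\setminus\{e\})$ is strongly biconnected for every $e\in E$ (equivalently, it has no b-bridges). -}

module Defs where

open import Data.Nat using (ℕ; zero; suc; _+_; _*_; _≤_)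
open import Data.Fin using (Fin; _≟_)
open import Data.Bool using (Bool; true; false; if_then_else_; _∧_; not)
open import Data.List using (List; map; allFin)
open import Data.Nat.ListAction using (sum)
open import Data.Product using (_×_; _,_)
open import Relation.Binary.PropositionalEquality using (_≡_; _≢_)
open import Relation.Nullary.Decidable using (⌊_⌋)

-- A (simple) directed graph on the vertex set V = Fin n is given by its
-- edge set E ⊆ V × V, represented as a Boolean adjacency relation:
-- (u , v) ∈ E  iff  E u v ≡ true.
EdgeSet : ℕ → Set
EdgeSet n = Fin n → Fin n → Bool

Edge : ℕ → Set
Edge n = Fin n × Fin n

_∈E_ : ∀ {n} → Edge n → EdgeSet n → Set
(u , v) ∈E E = E u v ≡ true

_⊆E_ : ∀ {n} → EdgeSet n → EdgeSet n → Set
U ⊆E E = ∀ u v → U u v ≡ true → E u v ≡ true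

removeEdge : ∀ {n} → EdgeSet n → Edge n → EdgeSet n
removeEdge E (a , b) u v = E u v ∧ not (⌊ u ≟ a ⌋ ∧ ⌊ v ≟ b ⌋)

edgeCount : ∀ {n} → EdgeSet n → ℕ
edgeCount {n} E =
  sum (map (λ u → sum (map (λ v → if E u v then 1 else 0) (allFin n))) (allFin n))

data Reach {n} (E : EdgeSet n) : Fin n → Fin n → Set where
  here : ∀ {u} → Reach E u u
  step : ∀ {u w v} → E u w ≡ true → Reach E w v → Reach E u v

StronglyConnected : ∀ {n} → EdgeSet n → Set
StronglyConnected {n} E = ∀ (u v : Fin n) → Reach E u v

-- Reachability in the underlying undirected graph, using only vertices
-- satisfying the predicate P (used for vertex deletion).
data UReachIn {n} (E : EdgeSet n) (P : Fin n → Set) : Fin n → Fin n → Set where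
  here : ∀ {u} → P u → UReachIn E P u u
  fwd  : ∀ {u w v} → P u → E u w ≡ true → UReachIn E P w v → UReachIn E P u v
  bwd  : ∀ {u w v} → P u → E w u ≡ true → UReachIn E P w v → UReachIn E P u v

UConnected : ∀ {n} → EdgeSet n → Set
UConnected {n} E = ∀ (u v : Fin n) → UReachIn E (λ _ → Fin n) u v

UBiconnected : ∀ {n} → EdgeSet n → Set
UBiconnected {n} E =
  UConnected E ×
  (∀ (x u v : Fin n) → u ≢ x → v ≢ x → UReachIn E (λ w → w ≢ x) u v)

StronglyBiconnected : ∀ {n} → EdgeSet n → Set
StronglyBiconnected E = StronglyConnected E × UBiconnected E

TwoEdgeStronglyBiconnected : ∀ {n} → EdgeSet n → Set
TwoEdgeStronglyBiconnected {n} E =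
  3 ≤ n × StronglyBiconnected E ×
  (∀ (e : Edge n) → e ∈E E → StronglyBiconnected (removeEdge E e))

OptimalM2ESBSS : ∀ {n} → EdgeSet n → EdgeSet n → Set
OptimalM2ESBSS {n} E U =
  U ⊆E E × TwoEdgeStronglyBiconnected U ×
  (∀ (U' : EdgeSet n) → U' ⊆E E → TwoEdgeStronglyBiconnected U' →
     edgeCount U ≤ edgeCount U')

{-# OPTIONS --safe #-}
module Submission where

-- Every vertex u of U has out-degree at least 2: since n ≥ 2 there is a vertex
-- v ≠ u, so a u–v path in U leaves u along some edge (u , w₁); U without that
-- edge is still strongly connected, so a second u–v path leaves u along an edge
-- (u , w₂) with w₂ ≠ w₁. Summing out-degrees gives |U| ≥ 2n.

open import Defs
open import Data.Nat using (ℕ; zero; suc; _+_; _*_; _≤_; z≤n; s≤s)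
open import Data.Nat.Properties using (≤-trans; m≤m+n; m≤n+m; +-mono-≤; +-monoʳ-≤; +-comm; *-zeroʳ; *-suc)
open import Data.Fin using (Fin; zero; suc; _≟_)
open import Data.Bool using (true; false; if_then_else_)
open import Data.List using (map; allFin; tabulate)
open import Data.List.Properties using (map-tabulate)
open import Data.Nat.ListAction using (sum)
open import Data.Product using (_,_; proj₁; ∃; ∃₂; _×_)
open import Data.Empty using (⊥-elim)
open import Relation.Nullary using (yes; no)
open import Relation.Binary.PropositionalEquality

private
  variable
    n : ℕ

sum-tabulate-≥-one : (f : Fin n → ℕ) (a : Fin n) → f a ≤ sum (tabulate f)
sum-tabulate-≥-one f zero    = m≤m+n _ _
sum-tabulate-≥-one f (suc a) = ≤-trans (sum-tabulate-≥-one (λ i → f (suc i)) a) (m≤n+m _ (f zero))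

sum-tabulate-≥-two : (f : Fin n → ℕ) {a b : Fin n} → a ≢ b → f a + f b ≤ sum (tabulate f)
sum-tabulate-≥-two f {zero}  {zero}  a≢b = ⊥-elim (a≢b refl)
sum-tabulate-≥-two f {zero}  {suc b} _   = +-monoʳ-≤ (f zero) (sum-tabulate-≥-one (λ i → f (suc i)) b)
sum-tabulate-≥-two f {suc a} {zero}  _   = subst (_≤ sum (tabulate f)) (+-comm (f zero) (f (suc a)))
  (+-monoʳ-≤ (f zero) (sum-tabulate-≥-one (λ i → f (suc i)) a))
sum-tabulate-≥-two f {suc a} {suc b} a≢b =
  ≤-trans (sum-tabulate-≥-two (λ i → f (suc i)) (λ a≡b → a≢b (cong suc a≡b))) (m≤n+m _ (f zero))

sum-tabulate-≥-* : ∀ k (f : Fin n → ℕ) → (∀ i → k ≤ f i) → k * n ≤ sum (tabulate f)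
sum-tabulate-≥-* {zero}  k f _  = subst (_≤ 0) (sym (*-zeroʳ k)) z≤n
sum-tabulate-≥-* {suc n} k f k≤ = subst (_≤ sum (tabulate f)) (sym (*-suc k n))
  (+-mono-≤ (k≤ zero) (sum-tabulate-≥-* k (λ i → f (suc i)) (λ i → k≤ (suc i))))

sum-map-allFin : (f : Fin n → ℕ) → sum (map f (allFin n)) ≡ sum (tabulate f)
sum-map-allFin f = cong sum (map-tabulate (λ i → i) f)

outDegree : EdgeSet n → Fin n → ℕ
outDegree {n} E u = sum (map (λ v → if E u v then 1 else 0) (allFin n))

outDegree-≥2 : (E : EdgeSet n) {u a b : Fin n} →
               E u a ≡ true → E u b ≡ true → a ≢ b → 2 ≤ outDegree E u
outDegree-≥2 E {u} {a} {b} ua ub a≢b =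
  subst (2 ≤_) (sym (sum-map-allFin indicator))
    (≤-trans (+-mono-≤ (one≤ ua) (one≤ ub)) (sum-tabulate-≥-two indicator a≢b))
  where
  indicator : Fin _ → ℕ
  indicator v = if E u v then 1 else 0
  one≤ : ∀ {v} → E u v ≡ true → 1 ≤ indicator v
  one≤ uv rewrite uv = s≤s z≤n

edgeCount-≥-* : ∀ k (E : EdgeSet n) → (∀ u → k ≤ outDegree E u) → k * n ≤ edgeCount E
edgeCount-≥-* k E k≤ = subst (k * _ ≤_) (sym (sum-map-allFin (outDegree E))) (sum-tabulate-≥-* k (outDegree E) k≤)

removeEdge-⊆ : (E : EdgeSet n) (e : Edge n) → removeEdge E e ⊆E E
removeEdge-⊆ E (a , b) u v uv with E u v
... | true  = refl
... | false = uv

removeEdge-removes : (E : EdgeSet n) (a b : Fin n) → removeEdge E (a , b) a b ≡ false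
removeEdge-removes E a b with E a b | a ≟ a | b ≟ b
... | false | _     | _     = refl
... | true  | yes _ | yes _ = refl
... | true  | no a≢a | _    = ⊥-elim (a≢a refl)
... | true  | yes _ | no b≢b = ⊥-elim (b≢b refl)

Reach⇒outNeighbour : (E : EdgeSet n) {u v : Fin n} → Reach E u v → u ≢ v → ∃ λ w → E u w ≡ true
Reach⇒outNeighbour E here          u≢u = ⊥-elim (u≢u refl)
Reach⇒outNeighbour E (step uw _) _   = _ , uw

another-vertex : 2 ≤ n → (u : Fin n) → ∃ λ v → u ≢ v
another-vertex (s≤s (s≤s _)) zero    = suc zero , λ ()
another-vertex (s≤s (s≤s _)) (suc u) = zero , λ ()

two-outNeighbours : (E : EdgeSet n) → 2 ≤ n → StronglyConnected E →
                    (∀ e → e ∈E E → StronglyConnected (removeEdge E e)) →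
                    (u : Fin n) → ∃₂ λ a b → E u a ≡ true × E u b ≡ true × a ≢ b
two-outNeighbours E 2≤n sc sc-rm u with another-vertex 2≤n u
... | v , u≢v with Reach⇒outNeighbour E (sc u v) u≢v
... | a , ua with Reach⇒outNeighbour (removeEdge E (u , a)) (sc-rm (u , a) ua u v) u≢v
... | b , ub′ = a , b , ua , removeEdge-⊆ E (u , a) u b ub′ , a≢b
  where
  a≢b : a ≢ b
  a≢b refl with trans (sym ub′) (removeEdge-removes E u a)
  ... | ()

mainTheorem2 : ∀ (n : ℕ) (E U : EdgeSet n) → TwoEdgeStronglyBiconnected E → OptimalM2ESBSS E U → 2 * n ≤ edgeCount U
mainTheorem2 n E U _ (_ , (3≤n , (sc , _) , sb-rm) , _) = edgeCount-≥-* 2 U degree≥2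
  where
  degree≥2 : ∀ u → 2 ≤ outDegree U u
  degree≥2 u with two-outNeighbours U (≤-trans (s≤s (s≤s z≤n)) 3≤n) sc (λ e e∈U → proj₁ (sb-rm e e∈U)) u
  ... | a , b , ua , ub , a≢b = outDegree-≥2 U ua ub a≢b
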